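{- Let $M_1,M_2$ be matroids on ground sets $E_1,E_2$ with $E_1\cap E_2=X$, such that $M_1|X=M_2|X$, $X$ is a modular flat of $M_2$, and $M_2|X\cong U_{2,n}$ for some $n\ge 2$. A subset $F\subseteq E_1\cup E_2$ is a corank-2 flat of $P_X(M_1,M_2)$ if and only if one of the following holds: (1) $E_1\subseteq F$ and $F\cap E_2$ is a corank-2 flat of $M_2$ containing $X$; (2) $E_2\subseteq F$ and $F\cap E_1$ is a corank-2 flat of $M_1$ containing $X$; (3) for each $i=1,2$, $F\cap E_i$ is a hyperplane of $M_i$ containing $X$; (4) $|F\cap X|=1$, $F\cap E_1$ is a hyperplane of $M_1$, and $F\cap E_2$ is a corank-2 flat of $M_2$; (5) $|F\cap X|=1$, $F\cap E_1$ is a corank-2 flat of $M_1$, and $F\cap E_2$ is a hyperplane of $M_2$; (6) $F\cap X=\varnothing$, $F\cap E_1$ is a hyperplane of $M_1$, and $F\cap E_2$ is a corank-3 flat of $M_2$; (7) $F\cap X=\varnothing$ and $F\cap E_i$ is a corank-2 flat of $M_i$ for $i=1,2$.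
   Context: A flat $T$ of a matroid $N$ with rank function $r$ is modular if $r(T)+r(F)=r(T\cap F)+r(T\cup F)$ for every flat $F$ of $N$. If $M_1|X=M_2|X$ and $X$ is a modular flat of at least one of $M_1,M_2$, the generalized parallel connection $P_X(M_1,M_2)$ is the matroid on $E_1\cup E_2$ whose flats are exactly the sets $F$ with $F\cap E_i$ a flat of $M_i$ for $i=1,2$. $U_{2,n}$ is the uniform matroid of rank $2$ on $n$ elements. -}

module Defs where

open import Data.Nat using (ℕ; _≤_; _<_; _+_; _⊓_)
open import Data.Fin using (Fin)
open import Data.Fin.Subset using (Subset; _∈_; _∉_; _⊆_; _∩_; _∪_; ⁅_⁆; ∣_∣)
open import Data.Product using (Σ; _×_)
open import Relation.Binary.PropositionalEquality using (_≡_)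

-- Matroids on a ground set E contained in a fixed finite universe Fin N,
-- given by their rank function (axioms R1-R3 on subsets of E).
record Matroid (N : ℕ) : Set where
  field
    ground : Subset N
    rank   : Subset N → ℕ
    rank-≤-card : ∀ A → A ⊆ ground → rank A ≤ ∣ A ∣
    rank-mono   : ∀ A B → A ⊆ B → B ⊆ ground → rank A ≤ rank B
    rank-submod : ∀ A B → A ⊆ ground → B ⊆ ground →
                  rank (A ∪ B) + rank (A ∩ B) ≤ rank A + rank B
open Matroid public

IsFlat : ∀ {N} → Matroid N → Subset N → Set
IsFlat M F = F ⊆ ground M × (∀ e → e ∈ ground M → e ∉ F → rank M F < rank M (F ∪ ⁅ e ⁆))

CorankFlat : ∀ {N} → ℕ → Matroid N → Subset N → Set
CorankFlat k M F = IsFlat M F × rank M (ground M) ≡ rank M F + k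

IsHyperplane : ∀ {N} → Matroid N → Subset N → Set
IsHyperplane = CorankFlat 1

RestrictionsEqual : ∀ {N} → Matroid N → Matroid N → Subset N → Set
RestrictionsEqual M₁ M₂ X =
  X ⊆ ground M₁ × X ⊆ ground M₂ × (∀ Y → Y ⊆ X → rank M₁ Y ≡ rank M₂ Y)

IsModularFlat : ∀ {N} → Matroid N → Subset N → Set
IsModularFlat M T =
  IsFlat M T × (∀ F → IsFlat M F → rank M T + rank M F ≡ rank M (T ∩ F) + rank M (T ∪ F))

-- rank function of U_{2,n}: r(Y) = min(2, |Y|)
-- M|X ≅ U_{2,n}: |X| = n and the rank of M restricted to X is that of U_{2,|X|}
RestrictionIsU2 : ∀ {N} → Matroid N → Subset N → ℕ → Set
RestrictionIsU2 M X n =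
  X ⊆ ground M × ∣ X ∣ ≡ n × (∀ Y → Y ⊆ X → rank M Y ≡ 2 ⊓ ∣ Y ∣)

IsGenParallelConnection : ∀ {N} → Subset N → Matroid N → Matroid N → Matroid N → Set
IsGenParallelConnection X M₁ M₂ P =
  ground P ≡ ground M₁ ∪ ground M₂ ×
  (∀ F → F ⊆ ground M₁ ∪ ground M₂ →
     (IsFlat P F → IsFlat M₁ (F ∩ ground M₁) × IsFlat M₂ (F ∩ ground M₂)) ×
     (IsFlat M₁ (F ∩ ground M₁) × IsFlat M₂ (F ∩ ground M₂) → IsFlat P F))

-- For a flat F of P = P_X(M₁, M₂) write Fᵢ = F ∩ Eᵢ. The potential
-- Φ F = r₁(F₁) + r₂(X ∪ F₂) is strictly monotone on flats of P, and every proper flat of P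
-- lies below one whose potential is exactly one larger: enlarge F₂ while X ∪ F₂ does not
-- span M₂, otherwise enlarge F₁; modularity of X makes the two enlarged pieces glue to a
-- flat of P. Such a flat therefore covers F, so rank and potential grow together up to the
-- ground set, and with r₂(X) + r₂(F₂) = r₂(X ∩ F₂) + r₂(X ∪ F₂) this yields
--   corank_P(F) + r₂(X) = r₂(X ∩ F₂) + corank₁(F₁) + corank₂(F₂).
-- Here r₂(X) = 2 and r₂(X ∩ F₂) = min(2, |F ∩ X|), so corank 2 means that the two coranks
-- add up to 4 - min(2, |F ∩ X|). The seven cases are the solutions of this equation left
-- after using that corank₁(F₁) = 0 forces X ⊆ F and that r₂(X) ≤ r₂(X ∩ F₂) + corank₂(F₂).
module Submission where

open import Defs

open import Data.Bool.Properties using (T-≡)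
open import Data.Empty using (⊥-elim)
open import Data.Fin using (Fin) renaming (_≟_ to _≟ᶠ_)
open import Data.Fin.Properties using (¬∀⟶∃¬)
open import Data.Fin.Subset using (Subset; ⊥; _⊆_; _⊂_; _∩_; _∪_; ∣_∣; _∈_; _∉_; ⁅_⁆; _-_)
open import Data.Fin.Subset.Properties
  using (x∈p∩q⁺; x∈p∪q⁻; p⊆p∪q; q⊆p∪q; p∩q⊆p; p∩q⊆q; x∈⁅x⁆; x∈⁅y⁆⇒x≡y; ∣⁅x⁆∣≡1;
         _∈?_; _⊆?_; nonempty?; Empty-unique; p⊆q⇒∣p∣≤∣q∣; ∣⊥∣≡0; x∈p⇒∣p-x∣<∣p∣; x∈p∧x≢y⇒x∈p-y; p─q⊆p)
open import Data.Nat using (ℕ; zero; suc; _+_; _∸_; _⊓_; _≤_; _<_; _≥_; z<s; _≤?_; _<?_)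
open import Data.Nat.Properties
open import Algebra.Properties.CommutativeSemigroup +-commutativeSemigroup using (xy∙z≈xz∙y; x∙yz≈xz∙y)
open import Data.Nat.Tactic.RingSolver using (solve-∀)
open import Data.Product using (∃; _×_; _,_; proj₁; proj₂)
open import Data.Sum using (_⊎_; inj₁; inj₂)
open import Data.Vec using (tabulate)
open import Data.Vec.Properties using (lookup∘tabulate; []=⇒lookup; lookup⇒[]=)
open import Function.Bundles using (Equivalence; _⇔_; mk⇔)
open import Relation.Binary.PropositionalEquality
open import Relation.Nullary using (Dec; yes; no)
open import Relation.Nullary.Decidable using (_×-dec_; _→-dec_; isYes; toWitness; fromWitness)

module _ {n : ℕ} {p q : Subset n} {x : Fin n} where

  ∪⁺ˡ : x ∈ p → x ∈ p ∪ q
  ∪⁺ˡ = p⊆p∪q q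

  ∪⁺ʳ : x ∈ q → x ∈ p ∪ q
  ∪⁺ʳ = q⊆p∪q p q

  ∪⁻ : x ∈ p ∪ q → x ∈ p ⊎ x ∈ q
  ∪⁻ = x∈p∪q⁻ p q

  ∩⁺ : x ∈ p → x ∈ q → x ∈ p ∩ q
  ∩⁺ x∈p x∈q = x∈p∩q⁺ (x∈p , x∈q)

  ∩⁻ˡ : x ∈ p ∩ q → x ∈ p
  ∩⁻ˡ = p∩q⊆p p q

  ∩⁻ʳ : x ∈ p ∩ q → x ∈ q
  ∩⁻ʳ = p∩q⊆q p q

private variable
  n : ℕ
  p q t : Subset n

∪-least : p ⊆ t → q ⊆ t → p ∪ q ⊆ t
∪-least p⊆t q⊆t x∈ with ∪⁻ x∈
... | inj₁ x∈p = p⊆t x∈p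
... | inj₂ x∈q = q⊆t x∈q

∩-greatest : t ⊆ p → t ⊆ q → t ⊆ p ∩ q
∩-greatest t⊆p t⊆q x∈t = ∩⁺ (t⊆p x∈t) (t⊆q x∈t)

∪-monoʳ : q ⊆ t → p ∪ q ⊆ p ∪ t
∪-monoʳ q⊆t = ∪-least ∪⁺ˡ (λ x∈q → ∪⁺ʳ (q⊆t x∈q))

∩-monoˡ : p ⊆ q → p ∩ t ⊆ q ∩ t
∩-monoˡ p⊆q = ∩-greatest (λ x∈ → p⊆q (∩⁻ˡ x∈)) ∩⁻ʳ

∩-monoʳ : q ⊆ t → p ∩ q ⊆ p ∩ t
∩-monoʳ q⊆t = ∩-greatest ∩⁻ˡ (λ x∈ → q⊆t (∩⁻ʳ x∈))

x∈p⇒⁅x⁆⊆p : ∀ {n} {p : Subset n} {x} → x ∈ p → ⁅ x ⁆ ⊆ p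
x∈p⇒⁅x⁆⊆p {p = p} {x} x∈p y∈ = subst (_∈ p) (sym (x∈⁅y⁆⇒x≡y x y∈)) x∈p

⊆-dichotomy : ∀ {n} (p q : Subset n) → p ⊆ q ⊎ ∃ λ x → x ∈ p × x ∉ q
⊆-dichotomy {n} p q with p ⊆? q
... | yes p⊆q = inj₁ p⊆q
... | no p⊈q with ¬∀⟶∃¬ n (λ x → x ∈ p → x ∈ q) (λ x → x ∈? p →-dec x ∈? q) (λ f → p⊈q (f _))
...   | x , ¬x∈p⇒x∈q with x ∈? p
...     | yes x∈p = inj₂ (x , x∈p , λ x∈q → ¬x∈p⇒x∈q (λ _ → x∈q))
...     | no x∉p = ⊥-elim (¬x∈p⇒x∈q (λ x∈p → ⊥-elim (x∉p x∈p)))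

∣p∣≡0⇒p≡⊥ : ∣ p ∣ ≡ 0 → p ≡ ⊥
∣p∣≡0⇒p≡⊥ {p = p} ∣p∣≡0 = Empty-unique λ (x , x∈p) →
  <⇒≱ (subst (0 <_) (sym (∣⁅x⁆∣≡1 x)) z<s) (subst (∣ ⁅ x ⁆ ∣ ≤_) ∣p∣≡0 (p⊆q⇒∣p∣≤∣q∣ (x∈p⇒⁅x⁆⊆p x∈p)))

p≡⊥⇒∣p∣≡0 : ∀ {n} {p : Subset n} → p ≡ ⊥ → ∣ p ∣ ≡ 0
p≡⊥⇒∣p∣≡0 {n = n} refl = ∣⊥∣≡0 n

module MatroidProperties {N : ℕ} (M : Matroid N) where

  private
    E : Subset N
    E = ground M
    r : Subset N → ℕ
    r = rank M
    variable
      A B F G S : Subset N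
      e x : Fin N

  mono : A ⊆ B → B ⊆ E → r A ≤ r B
  mono = rank-mono M _ _

  submod : A ⊆ E → B ⊆ E → r (A ∪ B) + r (A ∩ B) ≤ r A + r B
  submod = rank-submod M _ _

  rank-cong : A ⊆ B → B ⊆ A → B ⊆ E → r A ≡ r B
  rank-cong A⊆B B⊆A B⊆E = ≤-antisym (mono A⊆B B⊆E) (mono B⊆A (λ x∈A → B⊆E (A⊆B x∈A)))

  rank-insert-≤ : A ⊆ E → e ∈ E → r (A ∪ ⁅ e ⁆) ≤ suc (r A)
  rank-insert-≤ {A} {e} A⊆E e∈E = begin
      r (A ∪ ⁅ e ⁆)                   ≤⟨ m≤m+n _ _ ⟩
      r (A ∪ ⁅ e ⁆) + r (A ∩ ⁅ e ⁆)   ≤⟨ submod A⊆E ⁅e⁆⊆E ⟩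
      r A + r ⁅ e ⁆                   ≤⟨ +-monoʳ-≤ (r A) r⁅e⁆≤1 ⟩
      r A + 1                         ≡⟨ +-comm (r A) 1 ⟩
      suc (r A)                       ∎
    where
    open ≤-Reasoning
    ⁅e⁆⊆E : ⁅ e ⁆ ⊆ E
    ⁅e⁆⊆E = x∈p⇒⁅x⁆⊆p e∈E
    r⁅e⁆≤1 : r ⁅ e ⁆ ≤ 1
    r⁅e⁆≤1 = ≤-trans (rank-≤-card M ⁅ e ⁆ ⁅e⁆⊆E) (≤-reflexive (∣⁅x⁆∣≡1 e))

  isFlat-rank-< : IsFlat M F → x ∈ E → x ∉ F → F ∪ ⁅ x ⁆ ⊆ G → G ⊆ E → r F < r G
  isFlat-rank-< (_ , closed) x∈E x∉F F+x⊆G G⊆E = <-≤-trans (closed _ x∈E x∉F) (mono F+x⊆G G⊆E)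

  isFlat-cong : IsFlat M A → A ⊆ B → B ⊆ A → IsFlat M B
  isFlat-cong {A} {B} (A⊆E , closed) A⊆B B⊆A = B⊆E , λ e e∈E e∉B →
    subst₂ _<_ (rank-cong A⊆B B⊆A B⊆E)
               (rank-cong (∪-least (λ x∈A → ∪⁺ˡ (A⊆B x∈A)) ∪⁺ʳ) (∪-least (λ x∈B → ∪⁺ˡ (B⊆A x∈B)) ∪⁺ʳ)
                          (∪-least B⊆E (x∈p⇒⁅x⁆⊆p e∈E)))
               (closed e e∈E (λ e∈A → e∉B (A⊆B e∈A)))
    where
    B⊆E : B ⊆ E
    B⊆E x∈B = A⊆E (B⊆A x∈B)

  ground-isFlat : IsFlat M E
  ground-isFlat = (λ x∈E → x∈E) , λ e e∈E e∉E → ⊥-elim (e∉E e∈E)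

  rank-∪-spanned : A ⊆ E → S ⊆ E → (∀ {e} → e ∈ S → r (A ∪ ⁅ e ⁆) ≤ r A) → r (A ∪ S) ≤ r A
  rank-∪-spanned {A} {S} A⊆E S⊆E spanned = go ∣ S ∣ ≤-refl (λ x∈S → x∈S)
    where
    go : ∀ m {T} → ∣ T ∣ ≤ m → T ⊆ S → r (A ∪ T) ≤ r A
    go m {T} ∣T∣≤m T⊆S with nonempty? T
    ... | no T-empty = mono (∪-least (λ x∈A → x∈A) (λ {x} x∈T → ⊥-elim (T-empty (x , x∈T)))) A⊆E
    go zero    ∣T∣≤m T⊆S | yes (x , x∈T) = ⊥-elim (n≮0 (<-≤-trans (x∈p⇒∣p-x∣<∣p∣ x∈T) ∣T∣≤m))
    go (suc m) {T} ∣T∣≤m T⊆S | yes (x , x∈T) = +-cancelʳ-≤ (r A) _ _ (begin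
        r (A ∪ T) + r A            ≤⟨ +-mono-≤ (mono A∪T⊆B₁∪B₂ (∪-least B₁⊆E B₂⊆E))
                                               (mono A⊆B₁∩B₂ (λ y∈ → B₁⊆E (∩⁻ˡ y∈))) ⟩
        r (B₁ ∪ B₂) + r (B₁ ∩ B₂)  ≤⟨ submod B₁⊆E B₂⊆E ⟩
        r B₁ + r B₂                ≤⟨ +-mono-≤ (go m ∣T-x∣≤m (λ y∈ → T⊆S (p─q⊆p T ⁅ x ⁆ y∈)))
                                               (spanned (T⊆S x∈T)) ⟩
        r A + r A                  ∎)
      where
      open ≤-Reasoning
      B₁ B₂ : Subset N
      B₁ = A ∪ (T - x)
      B₂ = A ∪ ⁅ x ⁆
      ∣T-x∣≤m : ∣ T - x ∣ ≤ m
      ∣T-x∣≤m = ≤-pred (<-≤-trans (x∈p⇒∣p-x∣<∣p∣ x∈T) ∣T∣≤m)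
      B₁⊆E : B₁ ⊆ E
      B₁⊆E = ∪-least A⊆E (λ y∈ → S⊆E (T⊆S (p─q⊆p T ⁅ x ⁆ y∈)))
      B₂⊆E : B₂ ⊆ E
      B₂⊆E = ∪-least A⊆E (x∈p⇒⁅x⁆⊆p (S⊆E (T⊆S x∈T)))
      A⊆B₁∩B₂ : A ⊆ B₁ ∩ B₂
      A⊆B₁∩B₂ = ∩-greatest ∪⁺ˡ ∪⁺ˡ
      A∪T⊆B₁∪B₂ : A ∪ T ⊆ B₁ ∪ B₂
      A∪T⊆B₁∪B₂ = ∪-least (λ y∈A → ∪⁺ˡ (∪⁺ˡ y∈A)) λ {y} y∈T → case y y∈T
        where
        case : ∀ y → y ∈ T → y ∈ B₁ ∪ B₂
        case y y∈T with y ≟ᶠ x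
        ... | yes refl = ∪⁺ʳ (∪⁺ʳ (x∈⁅x⁆ x))
        ... | no y≢x = ∪⁺ˡ (∪⁺ʳ (x∈p∧x≢y⇒x∈p-y y∈T y≢x))

  private
    spans? : ∀ A x → Dec (x ∈ E × r (A ∪ ⁅ x ⁆) ≤ r A)
    spans? A x = x ∈? E ×-dec r (A ∪ ⁅ x ⁆) ≤? r A

  cl : Subset N → Subset N
  cl A = tabulate λ x → isYes (spans? A x)

  ∈cl⁻ : x ∈ cl A → x ∈ E × r (A ∪ ⁅ x ⁆) ≤ r A
  ∈cl⁻ {x} {A} x∈ = toWitness {a? = spans? A x} (Equivalence.from T-≡
    (trans (sym (lookup∘tabulate (λ y → isYes (spans? A y)) x)) ([]=⇒lookup x∈)))

  ∈cl⁺ : x ∈ E → r (A ∪ ⁅ x ⁆) ≤ r A → x ∈ cl A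
  ∈cl⁺ {x} {A} x∈E spanned = lookup⇒[]= x (cl A)
    (trans (lookup∘tabulate (λ y → isYes (spans? A y)) x)
           (Equivalence.to T-≡ (fromWitness {a? = spans? A x} (x∈E , spanned))))

  cl⊆ground : cl A ⊆ E
  cl⊆ground x∈ = proj₁ (∈cl⁻ x∈)

  ⊆cl : A ⊆ E → A ⊆ cl A
  ⊆cl A⊆E x∈A = ∈cl⁺ (A⊆E x∈A) (mono (∪-least (λ y∈A → y∈A) (x∈p⇒⁅x⁆⊆p x∈A)) A⊆E)

  rank-cl : A ⊆ E → r (cl A) ≡ r A
  rank-cl A⊆E = ≤-antisym
    (≤-trans (mono ∪⁺ʳ (∪-least A⊆E cl⊆ground))
             (rank-∪-spanned A⊆E cl⊆ground (λ x∈ → proj₂ (∈cl⁻ x∈))))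
    (mono (⊆cl A⊆E) cl⊆ground)

  ∉cl⇒rank-< : x ∈ E → x ∉ cl A → r A < r (A ∪ ⁅ x ⁆)
  ∉cl⇒rank-< {x} {A} x∈E x∉cl with r (A ∪ ⁅ x ⁆) ≤? r A
  ... | yes spanned = ⊥-elim (x∉cl (∈cl⁺ x∈E spanned))
  ... | no ¬spanned = ≰⇒> ¬spanned

  cl-isFlat : A ⊆ E → IsFlat M (cl A)
  cl-isFlat {A} A⊆E = cl⊆ground , λ e e∈E e∉cl → begin-strict
    r (cl A)             ≡⟨ rank-cl A⊆E ⟩
    r A                  <⟨ ∉cl⇒rank-< e∈E e∉cl ⟩
    r (A ∪ ⁅ e ⁆)        ≤⟨ mono (∪-least (λ x∈A → ∪⁺ˡ (⊆cl A⊆E x∈A)) ∪⁺ʳ)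
                                 (∪-least cl⊆ground (x∈p⇒⁅x⁆⊆p e∈E)) ⟩
    r (cl A ∪ ⁅ e ⁆)     ∎
    where open ≤-Reasoning

  rank-cl-insert : IsFlat M F → e ∈ E → e ∉ F → r (cl (F ∪ ⁅ e ⁆)) ≡ suc (r F)
  rank-cl-insert (F⊆E , closed) e∈E e∉F =
    trans (rank-cl (∪-least F⊆E (x∈p⇒⁅x⁆⊆p e∈E)))
          (≤-antisym (rank-insert-≤ F⊆E e∈E) (closed _ e∈E e∉F))

  ∃-rank-increasing : A ⊆ E → r A < r E → ∃ λ e → e ∈ E × r A < r (A ∪ ⁅ e ⁆)
  ∃-rank-increasing {A} A⊆E rA<rE with ⊆-dichotomy E (cl A)
  ... | inj₁ E⊆cl = ⊥-elim (<⇒≱ rA<rE (≤-trans (mono E⊆cl cl⊆ground) (≤-reflexive (rank-cl A⊆E))))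
  ... | inj₂ (e , e∈E , e∉cl) = e , e∈E , ∉cl⇒rank-< e∈E e∉cl

  isFlat-∩-rank-< : IsFlat M F → x ∈ E → x ∉ F → r (B ∩ F) < r ((B ∩ F) ∪ ⁅ x ⁆)
  isFlat-∩-rank-< {F} {x} {B} (F⊆E , closed) x∈E x∉F = +-cancelˡ-< (r F) _ _ (begin-strict
    r F + r (B ∩ F)            <⟨ +-monoˡ-< _ (closed x x∈E x∉F) ⟩
    r (F ∪ ⁅ x ⁆) + r (B ∩ F)  ≤⟨ +-mono-≤ (mono (∪-monoʳ ∪⁺ʳ) (∪-least F⊆E C⊆E))
                                           (mono (∩-greatest ∩⁻ʳ ∪⁺ˡ) (λ y∈ → F⊆E (∩⁻ˡ y∈))) ⟩
    r (F ∪ C) + r (F ∩ C)      ≤⟨ submod F⊆E C⊆E ⟩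
    r F + r C                  ∎)
    where
    open ≤-Reasoning
    C : Subset N
    C = (B ∩ F) ∪ ⁅ x ⁆
    C⊆E : C ⊆ E
    C⊆E = ∪-least (λ y∈ → F⊆E (∩⁻ʳ y∈)) (x∈p⇒⁅x⁆⊆p x∈E)

  rank-≤-∩-isFlat⇒⊆ : IsFlat M F → B ⊆ E → r B ≤ r (B ∩ F) → B ⊆ F
  rank-≤-∩-isFlat⇒⊆ {F} {B} F-flat B⊆E rB≤ {x} x∈B with x ∈? F
  ... | yes x∈F = x∈F
  ... | no x∉F = ⊥-elim (<⇒≱ (isFlat-∩-rank-< F-flat (B⊆E x∈B) x∉F)
          (≤-trans (mono (∪-least ∩⁻ˡ (x∈p⇒⁅x⁆⊆p x∈B)) B⊆E) rB≤))

  cl-least : A ⊆ F → IsFlat M F → cl A ⊆ F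
  cl-least {A} {F} A⊆F F-flat@(F⊆E , _) = rank-≤-∩-isFlat⇒⊆ F-flat cl⊆ground (begin
    r (cl A)      ≡⟨ rank-cl A⊆E ⟩
    r A           ≤⟨ mono (∩-greatest (⊆cl A⊆E) A⊆F) (λ x∈ → cl⊆ground (∩⁻ˡ x∈)) ⟩
    r (cl A ∩ F)  ∎)
    where
    open ≤-Reasoning
    A⊆E : A ⊆ E
    A⊆E x∈A = F⊆E (A⊆F x∈A)

  isFlat⇒CorankFlat : IsFlat M F → CorankFlat (r E ∸ r F) M F
  isFlat⇒CorankFlat F-flat@(F⊆E , _) = F-flat , sym (m+[n∸m]≡n (mono F⊆E (λ x∈ → x∈)))

  CorankFlat-0⇒ground⊆ : CorankFlat 0 M F → E ⊆ F
  CorankFlat-0⇒ground⊆ {F} (F-flat@(F⊆E , _) , rE≡) = rank-≤-∩-isFlat⇒⊆ F-flat (λ x∈ → x∈) (begin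
    r E        ≡⟨ trans rE≡ (+-identityʳ (r F)) ⟩
    r F        ≤⟨ mono (∩-greatest F⊆E (λ x∈ → x∈)) (λ x∈ → ∩⁻ˡ x∈) ⟩
    r (E ∩ F)  ∎)
    where open ≤-Reasoning

  ground⊆⇒CorankFlat-0 : E ⊆ F → CorankFlat 0 M (F ∩ E)
  ground⊆⇒CorankFlat-0 {F} E⊆F =
    isFlat-cong ground-isFlat E⊆F∩E ∩⁻ʳ , trans (rank-cong E⊆F∩E ∩⁻ʳ ∩⁻ʳ) (sym (+-identityʳ _))
    where
    E⊆F∩E : E ⊆ F ∩ E
    E⊆F∩E = ∩-greatest E⊆F (λ x∈ → x∈)

module ModularFlatProperties {N : ℕ} (M : Matroid N) {T : Subset N} (T-modular : IsModularFlat M T) where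

  open MatroidProperties M

  private
    E : Subset N
    E = ground M
    r : Subset N → ℕ
    r = rank M
    variable
      F G Z : Subset N

    T⊆E : T ⊆ E
    T⊆E = proj₁ (proj₁ T-modular)

    modular : IsFlat M F → r T + r F ≡ r (T ∩ F) + r (T ∪ F)
    modular {F} = proj₂ T-modular F

  modular-∪-rank-shift : IsFlat M F → IsFlat M G → F ⊆ G → T ∩ G ⊆ F →
                         r G + r (T ∪ F) ≡ r F + r (T ∪ G)
  modular-∪-rank-shift {F} {G} F-flat@(F⊆E , _) G-flat F⊆G T∩G⊆F = +-cancelˡ-≡ (r T) _ _ (begin
    r T + (r G + r (T ∪ F))              ≡⟨ sym (+-assoc (r T) _ _) ⟩
    (r T + r G) + r (T ∪ F)              ≡⟨ cong (_+ r (T ∪ F)) (modular G-flat) ⟩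
    (r (T ∩ G) + r (T ∪ G)) + r (T ∪ F)  ≡⟨ xy∙z≈xz∙y (r (T ∩ G)) _ _ ⟩
    (r (T ∩ G) + r (T ∪ F)) + r (T ∪ G)  ≡⟨ cong (λ s → (s + r (T ∪ F)) + r (T ∪ G)) meets-equal ⟩
    (r (T ∩ F) + r (T ∪ F)) + r (T ∪ G)  ≡⟨ cong (_+ r (T ∪ G)) (sym (modular F-flat)) ⟩
    (r T + r F) + r (T ∪ G)              ≡⟨ +-assoc (r T) _ _ ⟩
    r T + (r F + r (T ∪ G))              ∎)
    where
    open ≡-Reasoning
    meets-equal : r (T ∩ G) ≡ r (T ∩ F)
    meets-equal = rank-cong (∩-greatest ∩⁻ˡ T∩G⊆F) (∩-monoʳ F⊆G) (λ x∈ → F⊆E (∩⁻ʳ x∈))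

  modular-cover-∩⊆ : IsFlat M F → IsFlat M G → F ⊆ G → r G ≡ suc (r F) →
                     r (T ∪ F) < r (T ∪ G) → T ∩ G ⊆ F
  modular-cover-∩⊆ {F} {G} F-flat@(F⊆E , _) G-flat@(G⊆E , _) F⊆G rG≡ joins-< =
    rank-≤-∩-isFlat⇒⊆ F-flat (λ x∈ → G⊆E (∩⁻ʳ x∈)) (≤-trans meet-≤ (mono (∩-greatest (∩-monoʳ F⊆G) ∩⁻ʳ) T∩G∩F⊆E))
    where
    open ≤-Reasoning
    T∩G∩F⊆E : (T ∩ G) ∩ F ⊆ E
    T∩G∩F⊆E x∈ = F⊆E (∩⁻ʳ x∈)
    meet-≤ : r (T ∩ G) ≤ r (T ∩ F)
    meet-≤ = +-cancelʳ-≤ (r (T ∪ G)) _ _ (begin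
      r (T ∩ G) + r (T ∪ G)        ≡⟨ sym (modular G-flat) ⟩
      r T + r G                    ≡⟨ trans (cong (r T +_) rG≡) (+-suc (r T) (r F)) ⟩
      suc (r T + r F)              ≡⟨ cong suc (modular F-flat) ⟩
      suc (r (T ∩ F) + r (T ∪ F))  ≡⟨ sym (+-suc (r (T ∩ F)) _) ⟩
      r (T ∩ F) + suc (r (T ∪ F))  ≤⟨ +-monoʳ-≤ (r (T ∩ F)) joins-< ⟩
      r (T ∩ F) + r (T ∪ G)        ∎)

  modular-cl-∪-∩-rank-≤ : IsFlat M F → Z ⊆ T → T ∩ F ⊆ Z → r (T ∩ cl (F ∪ Z)) ≤ r Z
  modular-cl-∪-∩-rank-≤ {F} {Z} F-flat@(F⊆E , _) Z⊆T T∩F⊆Z = +-cancelʳ-≤ (r (T ∪ C) + r (T ∩ F)) _ _ (begin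
    r (T ∩ C) + (r (T ∪ C) + r (T ∩ F))  ≡⟨ sym (+-assoc (r (T ∩ C)) _ _) ⟩
    (r (T ∩ C) + r (T ∪ C)) + r (T ∩ F)  ≡⟨ cong (_+ r (T ∩ F)) (sym (modular (cl-isFlat F∪Z⊆E))) ⟩
    (r T + r C) + r (T ∩ F)              ≡⟨ +-assoc (r T) _ _ ⟩
    r T + (r C + r (T ∩ F))              ≤⟨ +-monoʳ-≤ (r T) C-submod ⟩
    r T + (r F + r Z)                    ≡⟨ sym (+-assoc (r T) _ _) ⟩
    (r T + r F) + r Z                    ≡⟨ cong (_+ r Z) (modular F-flat) ⟩
    (r (T ∩ F) + r (T ∪ F)) + r Z        ≤⟨ +-monoˡ-≤ (r Z) (+-monoʳ-≤ (r (T ∩ F)) joins-≤) ⟩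
    (r (T ∩ F) + r (T ∪ C)) + r Z        ≡⟨ +-comm _ (r Z) ⟩
    r Z + (r (T ∩ F) + r (T ∪ C))        ≡⟨ cong (r Z +_) (+-comm (r (T ∩ F)) _) ⟩
    r Z + (r (T ∪ C) + r (T ∩ F))        ∎)
    where
    open ≤-Reasoning
    C : Subset N
    C = cl (F ∪ Z)
    Z⊆E : Z ⊆ E
    Z⊆E x∈Z = T⊆E (Z⊆T x∈Z)
    F∪Z⊆E : F ∪ Z ⊆ E
    F∪Z⊆E = ∪-least F⊆E Z⊆E
    joins-≤ : r (T ∪ F) ≤ r (T ∪ C)
    joins-≤ = mono (∪-monoʳ (λ x∈F → ⊆cl F∪Z⊆E (∪⁺ˡ x∈F))) (∪-least T⊆E cl⊆ground)
    C-submod : r C + r (T ∩ F) ≤ r F + r Z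
    C-submod = begin
      r C + r (T ∩ F)        ≤⟨ +-mono-≤ (≤-reflexive (rank-cl F∪Z⊆E))
                                         (mono (∩-greatest ∩⁻ʳ T∩F⊆Z) (λ x∈ → F⊆E (∩⁻ˡ x∈))) ⟩
      r (F ∪ Z) + r (F ∩ Z)  ≤⟨ submod F⊆E Z⊆E ⟩
      r F + r Z              ∎

  rank-≤-∩-rank+corank : ∀ {c} → CorankFlat c M F → r T ≤ r (T ∩ F) + c
  rank-≤-∩-rank+corank {F} {c} (F-flat@(F⊆E , _) , corank) = +-cancelʳ-≤ (r F) _ _ (begin
    r T + r F              ≡⟨ modular F-flat ⟩
    r (T ∩ F) + r (T ∪ F)  ≤⟨ +-monoʳ-≤ (r (T ∩ F)) (mono (∪-least T⊆E F⊆E) (λ x∈ → x∈)) ⟩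
    r (T ∩ F) + r E        ≡⟨ cong (r (T ∩ F) +_) corank ⟩
    r (T ∩ F) + (r F + c)  ≡⟨ x∙yz≈xz∙y (r (T ∩ F)) (r F) c ⟩
    (r (T ∩ F) + c) + r F  ∎)
    where open ≤-Reasoning

module GeneralizedParallelConnection {N : ℕ} (M₁ M₂ P : Matroid N)
  (restrictions-equal : RestrictionsEqual M₁ M₂ (ground M₁ ∩ ground M₂))
  (X-modular : IsModularFlat M₂ (ground M₁ ∩ ground M₂))
  (P-parallel : IsGenParallelConnection (ground M₁ ∩ ground M₂) M₁ M₂ P) where

  private
    E₁ E₂ X : Subset N
    E₁ = ground M₁
    E₂ = ground M₂
    X = E₁ ∩ E₂
    r₁ r₂ rᴾ : Subset N → ℕ
    r₁ = rank M₁
    r₂ = rank M₂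
    rᴾ = rank P
    module M₁ = MatroidProperties M₁
    module M₂ = MatroidProperties M₂
    module P = MatroidProperties P
    open ModularFlatProperties M₂ X-modular
    variable
      F G : Subset N
      x : Fin N

  Flat₁₂ : Subset N → Set
  Flat₁₂ F = F ⊆ E₁ ∪ E₂ × IsFlat M₁ (F ∩ E₁) × IsFlat M₂ (F ∩ E₂)

  ⊆ground-P : F ⊆ E₁ ∪ E₂ → F ⊆ ground P
  ⊆ground-P {F} = subst (F ⊆_) (sym (proj₁ P-parallel))

  Flat₁₂⇒IsFlat : Flat₁₂ F → IsFlat P F
  Flat₁₂⇒IsFlat {F} (F⊆E , F₁-flat , F₂-flat) = proj₂ (proj₂ P-parallel F F⊆E) (F₁-flat , F₂-flat)

  IsFlat⇒Flat₁₂ : IsFlat P F → Flat₁₂ F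
  IsFlat⇒Flat₁₂ {F} F-flat = F⊆E , proj₁ (proj₂ P-parallel F F⊆E) F-flat
    where
    F⊆E : F ⊆ E₁ ∪ E₂
    F⊆E = subst (F ⊆_) (proj₁ P-parallel) (proj₁ F-flat)

  Φ : Subset N → ℕ
  Φ F = r₁ (F ∩ E₁) + r₂ (X ∪ (F ∩ E₂))

  Φ-strictMono : Flat₁₂ F → Flat₁₂ G → F ⊆ G → x ∈ G → x ∉ F → Φ F < Φ G
  Φ-strictMono {F} {G} {x} (_ , F₁-flat , F₂-flat) (G⊆E , _ , G₂-flat@(G₂⊆E₂ , _)) F⊆G x∈G x∉F
    with ⊆-dichotomy (G ∩ E₁) (F ∩ E₁)
  ... | inj₂ (y , y∈G₁ , y∉F₁) =
    +-mono-<-≤ (M₁.isFlat-rank-< F₁-flat (∩⁻ʳ y∈G₁) y∉F₁ (∪-least (∩-monoˡ F⊆G) (x∈p⇒⁅x⁆⊆p y∈G₁)) ∩⁻ʳ)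
               (M₂.mono (∪-monoʳ (∩-monoˡ F⊆G)) (∪-least ∩⁻ʳ G₂⊆E₂))
  ... | inj₁ G₁⊆F₁ with ∪⁻ (G⊆E x∈G)
  ...   | inj₁ x∈E₁ = ⊥-elim (x∉F (∩⁻ˡ (G₁⊆F₁ (∩⁺ x∈G x∈E₁))))
  ...   | inj₂ x∈E₂ = +-mono-≤-< (M₁.mono (∩-monoˡ F⊆G) ∩⁻ʳ) joins-<
    where
    F₂⊆G₂ : F ∩ E₂ ⊆ G ∩ E₂
    F₂⊆G₂ = ∩-monoˡ F⊆G
    X∩G₂⊆F₂ : X ∩ (G ∩ E₂) ⊆ F ∩ E₂
    X∩G₂⊆F₂ y∈ = ∩⁺ (∩⁻ˡ (G₁⊆F₁ (∩⁺ (∩⁻ˡ (∩⁻ʳ y∈)) (∩⁻ˡ (∩⁻ˡ y∈))))) (∩⁻ʳ (∩⁻ʳ y∈))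
    F₂<G₂ : r₂ (F ∩ E₂) < r₂ (G ∩ E₂)
    F₂<G₂ = M₂.isFlat-rank-< F₂-flat x∈E₂ (λ x∈F₂ → x∉F (∩⁻ˡ x∈F₂))
              (∪-least F₂⊆G₂ (x∈p⇒⁅x⁆⊆p (∩⁺ x∈G x∈E₂))) G₂⊆E₂
    joins-< : r₂ (X ∪ (F ∩ E₂)) < r₂ (X ∪ (G ∩ E₂))
    joins-< = +-cancelˡ-< (r₂ (F ∩ E₂)) _ _ (begin-strict
      r₂ (F ∩ E₂) + r₂ (X ∪ (F ∩ E₂))   <⟨ +-monoˡ-< _ F₂<G₂ ⟩
      r₂ (G ∩ E₂) + r₂ (X ∪ (F ∩ E₂))   ≡⟨ modular-∪-rank-shift F₂-flat G₂-flat F₂⊆G₂ X∩G₂⊆F₂ ⟩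
      r₂ (F ∩ E₂) + r₂ (X ∪ (G ∩ E₂))   ∎)
      where open ≤-Reasoning

  Flat₁₂-∪ : ∀ {G₁ G₂} → IsFlat M₁ G₁ → IsFlat M₂ G₂ → X ∩ G₁ ⊆ G₂ → X ∩ G₂ ⊆ G₁ →
             Flat₁₂ (G₁ ∪ G₂) × Φ (G₁ ∪ G₂) ≡ r₁ G₁ + r₂ (X ∪ G₂)
  Flat₁₂-∪ {G₁} {G₂} G₁-flat@(G₁⊆E₁ , _) G₂-flat@(G₂⊆E₂ , _) X∩G₁⊆G₂ X∩G₂⊆G₁ =
    (∪-least (λ y∈ → ∪⁺ˡ (G₁⊆E₁ y∈)) (λ y∈ → ∪⁺ʳ (G₂⊆E₂ y∈)) ,
     M₁.isFlat-cong G₁-flat ⊆G∩E₁ G∩E₁⊆ ,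
     M₂.isFlat-cong G₂-flat ⊆G∩E₂ G∩E₂⊆) ,
    cong₂ _+_ (M₁.rank-cong G∩E₁⊆ ⊆G∩E₁ G₁⊆E₁)
              (M₂.rank-cong (∪-monoʳ G∩E₂⊆) (∪-monoʳ ⊆G∩E₂) (∪-least ∩⁻ʳ G₂⊆E₂))
    where
    ⊆G∩E₁ : G₁ ⊆ (G₁ ∪ G₂) ∩ E₁
    ⊆G∩E₁ = ∩-greatest ∪⁺ˡ G₁⊆E₁
    ⊆G∩E₂ : G₂ ⊆ (G₁ ∪ G₂) ∩ E₂
    ⊆G∩E₂ = ∩-greatest ∪⁺ʳ G₂⊆E₂
    G∩E₁⊆ : (G₁ ∪ G₂) ∩ E₁ ⊆ G₁
    G∩E₁⊆ y∈ with ∪⁻ (∩⁻ˡ y∈)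
    ... | inj₁ y∈G₁ = y∈G₁
    ... | inj₂ y∈G₂ = X∩G₂⊆G₁ (∩⁺ (∩⁺ (∩⁻ʳ y∈) (G₂⊆E₂ y∈G₂)) y∈G₂)
    G∩E₂⊆ : (G₁ ∪ G₂) ∩ E₂ ⊆ G₂
    G∩E₂⊆ y∈ with ∪⁻ (∩⁻ˡ y∈)
    ... | inj₁ y∈G₁ = X∩G₁⊆G₂ (∩⁺ (∩⁺ (G₁⊆E₁ y∈G₁) (∩⁻ʳ y∈)) y∈G₁)
    ... | inj₂ y∈G₂ = y∈G₂

  Φ-Successor : Subset N → Set
  Φ-Successor F = ∃ λ G → Flat₁₂ G × F ⊂ G × Φ G ≡ suc (Φ F)

  Φ-successor-in-M₂ : Flat₁₂ F → r₂ (X ∪ (F ∩ E₂)) < r₂ E₂ → Φ-Successor F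
  Φ-successor-in-M₂ {F} (F⊆E , F₁-flat , F₂-flat@(F₂⊆E₂ , _)) joins-<
    with M₂.∃-rank-increasing (∪-least ∩⁻ʳ F₂⊆E₂) joins-<
  ... | e , e∈E₂ , grows =
    F₁ ∪ G₂ , proj₁ glued , (F⊆G , e , ∪⁺ʳ e∈G₂ , λ e∈F → e∉F₂ (∩⁺ e∈F e∈E₂)) ,
    trans (proj₂ glued) (trans (cong (r₁ F₁ +_) joins-suc) (+-suc (r₁ F₁) _))
    where
    F₁ F₂ : Subset N
    F₁ = F ∩ E₁
    F₂ = F ∩ E₂
    e∉F₂ : e ∉ F₂
    e∉F₂ e∈F₂ = <⇒≱ grows (M₂.mono (∪-least (λ y∈ → y∈) (λ y∈ → ∪⁺ʳ (x∈p⇒⁅x⁆⊆p e∈F₂ y∈))) (∪-least ∩⁻ʳ F₂⊆E₂))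
    F₂+e⊆E₂ : F₂ ∪ ⁅ e ⁆ ⊆ E₂
    F₂+e⊆E₂ = ∪-least F₂⊆E₂ (x∈p⇒⁅x⁆⊆p e∈E₂)
    G₂ : Subset N
    G₂ = M₂.cl (F₂ ∪ ⁅ e ⁆)
    G₂-flat : IsFlat M₂ G₂
    G₂-flat = M₂.cl-isFlat F₂+e⊆E₂
    F₂⊆G₂ : F₂ ⊆ G₂
    F₂⊆G₂ y∈ = M₂.⊆cl F₂+e⊆E₂ (∪⁺ˡ y∈)
    e∈G₂ : e ∈ G₂
    e∈G₂ = M₂.⊆cl F₂+e⊆E₂ (∪⁺ʳ (x∈⁅x⁆ e))
    rG₂ : r₂ G₂ ≡ suc (r₂ F₂)
    rG₂ = M₂.rank-cl-insert F₂-flat e∈E₂ e∉F₂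
    joins-<G₂ : r₂ (X ∪ F₂) < r₂ (X ∪ G₂)
    joins-<G₂ = <-≤-trans grows (M₂.mono (∪-least (∪-monoʳ F₂⊆G₂) (λ y∈ → ∪⁺ʳ (x∈p⇒⁅x⁆⊆p e∈G₂ y∈)))
                                         (∪-least ∩⁻ʳ M₂.cl⊆ground))
    X∩G₂⊆F₂ : X ∩ G₂ ⊆ F₂
    X∩G₂⊆F₂ = modular-cover-∩⊆ F₂-flat G₂-flat F₂⊆G₂ rG₂ joins-<G₂
    joins-suc : r₂ (X ∪ G₂) ≡ suc (r₂ (X ∪ F₂))
    joins-suc = sym (+-cancelˡ-≡ (r₂ F₂) _ _ (begin
      r₂ F₂ + suc (r₂ (X ∪ F₂))  ≡⟨ +-suc (r₂ F₂) _ ⟩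
      suc (r₂ F₂) + r₂ (X ∪ F₂)  ≡⟨ cong (_+ r₂ (X ∪ F₂)) (sym rG₂) ⟩
      r₂ G₂ + r₂ (X ∪ F₂)        ≡⟨ modular-∪-rank-shift F₂-flat G₂-flat F₂⊆G₂ X∩G₂⊆F₂ ⟩
      r₂ F₂ + r₂ (X ∪ G₂)        ∎))
      where open ≡-Reasoning
    glued : Flat₁₂ (F₁ ∪ G₂) × Φ (F₁ ∪ G₂) ≡ r₁ F₁ + r₂ (X ∪ G₂)
    glued = Flat₁₂-∪ F₁-flat G₂-flat (λ y∈ → F₂⊆G₂ (∩⁺ (∩⁻ˡ (∩⁻ʳ y∈)) (∩⁻ʳ (∩⁻ˡ y∈))))
                                      (λ y∈ → ∩⁺ (∩⁻ˡ (X∩G₂⊆F₂ y∈)) (∩⁻ˡ (∩⁻ˡ y∈)))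
    F⊆G : F ⊆ F₁ ∪ G₂
    F⊆G y∈F with ∪⁻ (F⊆E y∈F)
    ... | inj₁ y∈E₁ = ∪⁺ˡ (∩⁺ y∈F y∈E₁)
    ... | inj₂ y∈E₂ = ∪⁺ʳ (F₂⊆G₂ (∩⁺ y∈F y∈E₂))

  Φ-successor-in-M₁ : Flat₁₂ F → r₂ (X ∪ (F ∩ E₂)) ≡ r₂ E₂ → x ∈ E₁ → x ∉ F → Φ-Successor F
  Φ-successor-in-M₁ {F} {x} (F⊆E , F₁-flat@(F₁⊆E₁ , _) , F₂-flat@(F₂⊆E₂ , _)) spanning x∈E₁ x∉F =
    G₁ ∪ G₂ , proj₁ glued , (F⊆G , x , ∪⁺ˡ x∈G₁ , x∉F) ,
    trans (proj₂ glued) (cong₂ _+_ rG₁ joins-≡)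
    where
    F₁ F₂ : Subset N
    F₁ = F ∩ E₁
    F₂ = F ∩ E₂
    F₁+x⊆E₁ : F₁ ∪ ⁅ x ⁆ ⊆ E₁
    F₁+x⊆E₁ = ∪-least F₁⊆E₁ (x∈p⇒⁅x⁆⊆p x∈E₁)
    G₁ : Subset N
    G₁ = M₁.cl (F₁ ∪ ⁅ x ⁆)
    G₁-flat : IsFlat M₁ G₁
    G₁-flat = M₁.cl-isFlat F₁+x⊆E₁
    F₁⊆G₁ : F₁ ⊆ G₁
    F₁⊆G₁ y∈ = M₁.⊆cl F₁+x⊆E₁ (∪⁺ˡ y∈)
    x∈G₁ : x ∈ G₁
    x∈G₁ = M₁.⊆cl F₁+x⊆E₁ (∪⁺ʳ (x∈⁅x⁆ x))
    rG₁ : r₁ G₁ ≡ suc (r₁ F₁)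
    rG₁ = M₁.rank-cl-insert F₁-flat x∈E₁ (λ x∈F₁ → x∉F (∩⁻ˡ x∈F₁))
    Z : Subset N
    Z = X ∩ G₁
    F₂∪Z⊆E₂ : F₂ ∪ Z ⊆ E₂
    F₂∪Z⊆E₂ = ∪-least F₂⊆E₂ (λ y∈ → ∩⁻ʳ (∩⁻ˡ y∈))
    G₂ : Subset N
    G₂ = M₂.cl (F₂ ∪ Z)
    G₂-flat : IsFlat M₂ G₂
    G₂-flat = M₂.cl-isFlat F₂∪Z⊆E₂
    F₂⊆G₂ : F₂ ⊆ G₂
    F₂⊆G₂ y∈ = M₂.⊆cl F₂∪Z⊆E₂ (∪⁺ˡ y∈)
    Z⊆G₂ : Z ⊆ G₂
    Z⊆G₂ y∈ = M₂.⊆cl F₂∪Z⊆E₂ (∪⁺ʳ y∈)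
    X∩F₂⊆Z : X ∩ F₂ ⊆ Z
    X∩F₂⊆Z y∈ = ∩⁺ (∩⁻ˡ y∈) (F₁⊆G₁ (∩⁺ (∩⁻ˡ (∩⁻ʳ y∈)) (∩⁻ˡ (∩⁻ˡ y∈))))
    X∩G₂⊆E₁ : X ∩ G₂ ⊆ E₁
    X∩G₂⊆E₁ y∈ = ∩⁻ˡ (∩⁻ˡ y∈)
    same-rank : ∀ {Y} → Y ⊆ X → r₁ Y ≡ r₂ Y
    same-rank = proj₂ (proj₂ restrictions-equal) _
    X∩G₂⊆G₁ : X ∩ G₂ ⊆ G₁
    X∩G₂⊆G₁ = M₁.rank-≤-∩-isFlat⇒⊆ G₁-flat X∩G₂⊆E₁ (begin
      r₁ (X ∩ G₂)         ≡⟨ same-rank ∩⁻ˡ ⟩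
      r₂ (X ∩ G₂)         ≤⟨ modular-cl-∪-∩-rank-≤ F₂-flat ∩⁻ˡ X∩F₂⊆Z ⟩
      r₂ Z                ≡⟨ sym (same-rank ∩⁻ˡ) ⟩
      r₁ Z                ≤⟨ M₁.mono (λ y∈ → ∩⁺ (∩⁺ (∩⁻ˡ y∈) (Z⊆G₂ y∈)) (∩⁻ʳ y∈)) (λ y∈ → X∩G₂⊆E₁ (∩⁻ˡ y∈)) ⟩
      r₁ ((X ∩ G₂) ∩ G₁)  ∎)
      where open ≤-Reasoning
    glued : Flat₁₂ (G₁ ∪ G₂) × Φ (G₁ ∪ G₂) ≡ r₁ G₁ + r₂ (X ∪ G₂)
    glued = Flat₁₂-∪ G₁-flat G₂-flat Z⊆G₂ X∩G₂⊆G₁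
    joins-≡ : r₂ (X ∪ G₂) ≡ r₂ (X ∪ F₂)
    joins-≡ = ≤-antisym (≤-trans (M₂.mono (∪-least ∩⁻ʳ M₂.cl⊆ground) (λ y∈ → y∈)) (≤-reflexive (sym spanning)))
                        (M₂.mono (∪-monoʳ F₂⊆G₂) (∪-least ∩⁻ʳ M₂.cl⊆ground))
    F⊆G : F ⊆ G₁ ∪ G₂
    F⊆G y∈F with ∪⁻ (F⊆E y∈F)
    ... | inj₁ y∈E₁ = ∪⁺ˡ (F₁⊆G₁ (∩⁺ y∈F y∈E₁))
    ... | inj₂ y∈E₂ = ∪⁺ʳ (F₂⊆G₂ (∩⁺ y∈F y∈E₂))

  Φ-successor : Flat₁₂ F → x ∈ E₁ ∪ E₂ → x ∉ F → Φ-Successor F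
  Φ-successor {F} {x} F₁₂@(_ , _ , F₂-flat@(F₂⊆E₂ , _)) x∈E x∉F with r₂ (X ∪ (F ∩ E₂)) <? r₂ E₂
  ... | yes joins-< = Φ-successor-in-M₂ F₁₂ joins-<
  ... | no joins-≮ with ⊆-dichotomy E₁ F
  ...   | inj₂ (y , y∈E₁ , y∉F) = Φ-successor-in-M₁ F₁₂ spanning y∈E₁ y∉F
    where
    spanning : r₂ (X ∪ (F ∩ E₂)) ≡ r₂ E₂
    spanning = ≤-antisym (M₂.mono (∪-least ∩⁻ʳ F₂⊆E₂) (λ y∈ → y∈)) (≮⇒≥ joins-≮)
  ...   | inj₁ E₁⊆F with ∪⁻ x∈E
  ...     | inj₁ x∈E₁ = ⊥-elim (x∉F (E₁⊆F x∈E₁))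
  ...     | inj₂ x∈E₂ = ⊥-elim (joins-≮ (≤-<-trans (M₂.mono X∪F₂⊆F₂ F₂⊆E₂) F₂<E₂))
    where
    F₂<E₂ : r₂ (F ∩ E₂) < r₂ E₂
    F₂<E₂ = M₂.isFlat-rank-< F₂-flat x∈E₂ (λ x∈F₂ → x∉F (∩⁻ˡ x∈F₂))
                             (∪-least F₂⊆E₂ (x∈p⇒⁅x⁆⊆p x∈E₂)) (λ y∈ → y∈)
    X∪F₂⊆F₂ : X ∪ (F ∩ E₂) ⊆ F ∩ E₂
    X∪F₂⊆F₂ = ∪-least (λ y∈ → ∩⁺ (E₁⊆F (∩⁻ˡ y∈)) (∩⁻ʳ y∈)) (λ y∈ → y∈)

  Φ-successor-covers : Flat₁₂ F → Flat₁₂ G → F ⊂ G → Φ G ≡ suc (Φ F) → rᴾ G ≡ suc (rᴾ F)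
  Φ-successor-covers {F} {G} F₁₂@(F⊆E , _) G₁₂@(G⊆E , _) (F⊆G , e , e∈G , e∉F) ΦG
    with ⊆-dichotomy G (P.cl (F ∪ ⁅ e ⁆))
  ... | inj₁ G⊆H = ≤-antisym (≤-trans (P.mono G⊆H P.cl⊆ground) (≤-reflexive rH))
                             (P.isFlat-rank-< F-flat e∈ground e∉F (∪-least F⊆G (x∈p⇒⁅x⁆⊆p e∈G)) (⊆ground-P G⊆E))
    where
    F-flat : IsFlat P F
    F-flat = Flat₁₂⇒IsFlat F₁₂
    e∈ground : e ∈ ground P
    e∈ground = ⊆ground-P G⊆E e∈G
    rH : rᴾ (P.cl (F ∪ ⁅ e ⁆)) ≡ suc (rᴾ F)
    rH = P.rank-cl-insert F-flat e∈ground e∉F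
  ... | inj₂ (z , z∈G , z∉H) = ⊥-elim (<⇒≱ (Φ-strictMono H₁₂ G₁₂ H⊆G z∈G z∉H)
                                          (≤-trans (≤-reflexive ΦG) (Φ-strictMono F₁₂ H₁₂ F⊆H e∈H e∉F)))
    where
    H : Subset N
    H = P.cl (F ∪ ⁅ e ⁆)
    F+e⊆ground : F ∪ ⁅ e ⁆ ⊆ ground P
    F+e⊆ground = ⊆ground-P (∪-least F⊆E (x∈p⇒⁅x⁆⊆p (G⊆E e∈G)))
    H₁₂ : Flat₁₂ H
    H₁₂ = IsFlat⇒Flat₁₂ (P.cl-isFlat F+e⊆ground)
    F⊆H : F ⊆ H
    F⊆H y∈ = P.⊆cl F+e⊆ground (∪⁺ˡ y∈)
    e∈H : e ∈ H
    e∈H = P.⊆cl F+e⊆ground (∪⁺ʳ (x∈⁅x⁆ e))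
    H⊆G : H ⊆ G
    H⊆G = P.cl-least (∪-least F⊆G (x∈p⇒⁅x⁆⊆p e∈G)) (Flat₁₂⇒IsFlat G₁₂)

  corank-formula : Flat₁₂ F → rᴾ (ground P) + Φ F ≡ rᴾ F + (r₁ E₁ + r₂ E₂)
  corank-formula {F} F₁₂@(F⊆E , _) = go _ F₁₂ (sym (m∸n+n≡m (P.mono (⊆ground-P F⊆E) (λ y∈ → y∈))))
    where
    go : ∀ k {F} → Flat₁₂ F → rᴾ (ground P) ≡ k + rᴾ F → rᴾ (ground P) + Φ F ≡ rᴾ F + (r₁ E₁ + r₂ E₂)
    go k {F} F₁₂@(F⊆E , _) corank with ⊆-dichotomy (E₁ ∪ E₂) F
    ... | inj₁ E⊆F = cong₂ _+_
      (P.rank-cong (λ y∈ → E⊆F (subst (_ ∈_) (proj₁ P-parallel) y∈)) (⊆ground-P F⊆E) (⊆ground-P F⊆E))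
      (cong₂ _+_ (M₁.rank-cong ∩⁻ʳ (λ y∈ → ∩⁺ (E⊆F (∪⁺ˡ y∈)) y∈) (λ y∈ → y∈))
                 (M₂.rank-cong (∪-least ∩⁻ʳ ∩⁻ʳ) (λ y∈ → ∪⁺ʳ (∩⁺ (E⊆F (∪⁺ʳ y∈)) y∈)) (λ y∈ → y∈)))
    ... | inj₂ (x , x∈E , x∉F) with Φ-successor F₁₂ x∈E x∉F | k
    ...   | _ | zero = ⊥-elim (<-irrefl (sym corank)
            (P.isFlat-rank-< (Flat₁₂⇒IsFlat F₁₂) x∈ground x∉F
                             (∪-least (⊆ground-P F⊆E) (x∈p⇒⁅x⁆⊆p x∈ground)) (λ y∈ → y∈)))
      where
      x∈ground : x ∈ ground P
      x∈ground = ⊆ground-P (λ y∈ → y∈) x∈E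
    ...   | G , G₁₂ , F⊂G , ΦG | suc k = suc-injective (begin
      suc (rᴾ (ground P) + Φ F)     ≡⟨ sym (+-suc (rᴾ (ground P)) (Φ F)) ⟩
      rᴾ (ground P) + suc (Φ F)     ≡⟨ cong (rᴾ (ground P) +_) (sym ΦG) ⟩
      rᴾ (ground P) + Φ G           ≡⟨ go k G₁₂ (trans corank (trans (sym (+-suc k (rᴾ F))) (cong (k +_) (sym rG)))) ⟩
      rᴾ G + (r₁ E₁ + r₂ E₂)        ≡⟨ cong (_+ (r₁ E₁ + r₂ E₂)) rG ⟩
      suc (rᴾ F + (r₁ E₁ + r₂ E₂))  ∎)
      where
      open ≡-Reasoning
      rG : rᴾ G ≡ suc (rᴾ F)
      rG = Φ-successor-covers F₁₂ G₁₂ F⊂G ΦG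

  corank-identity : ∀ {c₁ c₂} → F ⊆ E₁ ∪ E₂ → CorankFlat c₁ M₁ (F ∩ E₁) → CorankFlat c₂ M₂ (F ∩ E₂) →
                    rᴾ (ground P) + r₂ X ≡ rᴾ F + (r₂ (X ∩ (F ∩ E₂)) + (c₁ + c₂))
  corank-identity {F} {c₁} {c₂} F⊆E (F₁-flat , corank₁) (F₂-flat , corank₂) =
    +-cancelʳ-≡ (a + u) _ _ (begin
      (R + r₂ X) + (a + u)                       ≡⟨ xy∙z≈xz∙y R (r₂ X) (a + u) ⟩
      (R + (a + u)) + r₂ X                       ≡⟨ cong (_+ r₂ X) (corank-formula (F⊆E , F₁-flat , F₂-flat)) ⟩
      (ρ + (r₁ E₁ + r₂ E₂)) + r₂ X               ≡⟨ cong (λ t → (ρ + t) + r₂ X) (cong₂ _+_ corank₁ corank₂) ⟩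
      (ρ + ((a + c₁) + (b + c₂))) + r₂ X         ≡⟨ regroup₁ ρ a b c₁ c₂ (r₂ X) ⟩
      (ρ + (c₁ + c₂)) + (a + (r₂ X + b))         ≡⟨ cong (λ t → (ρ + (c₁ + c₂)) + (a + t)) (proj₂ X-modular _ F₂-flat) ⟩
      (ρ + (c₁ + c₂)) + (a + (s + u))            ≡⟨ regroup₂ ρ a c₁ c₂ s u ⟩
      (ρ + (s + (c₁ + c₂))) + (a + u)            ∎)
    where
    open ≡-Reasoning
    R ρ a b s u : ℕ
    R = rᴾ (ground P)
    ρ = rᴾ F
    a = r₁ (F ∩ E₁)
    b = r₂ (F ∩ E₂)
    s = r₂ (X ∩ (F ∩ E₂))
    u = r₂ (X ∪ (F ∩ E₂))
    regroup₁ : ∀ ρ a b c₁ c₂ k → (ρ + ((a + c₁) + (b + c₂))) + k ≡ (ρ + (c₁ + c₂)) + (a + (k + b))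
    regroup₁ = solve-∀
    regroup₂ : ∀ ρ a c₁ c₂ s u → (ρ + (c₁ + c₂)) + (a + (s + u)) ≡ (ρ + (s + (c₁ + c₂))) + (a + u)
    regroup₂ = solve-∀

  CorankFlat⇔ : ∀ {k c₁ c₂} → F ⊆ E₁ ∪ E₂ → CorankFlat c₁ M₁ (F ∩ E₁) → CorankFlat c₂ M₂ (F ∩ E₂) →
                CorankFlat k P F ⇔ (k + r₂ X ≡ r₂ (X ∩ (F ∩ E₂)) + (c₁ + c₂))
  CorankFlat⇔ {F} {k} {c₁} {c₂} F⊆E F₁-corank@(F₁-flat , _) F₂-corank@(F₂-flat , _) = mk⇔
    (λ (_ , corank) → +-cancelˡ-≡ (rᴾ F) _ _ (begin
      rᴾ F + (k + r₂ X)                       ≡⟨ sym (+-assoc (rᴾ F) k _) ⟩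
      (rᴾ F + k) + r₂ X                       ≡⟨ cong (_+ r₂ X) (sym corank) ⟩
      rᴾ (ground P) + r₂ X                    ≡⟨ identity ⟩
      rᴾ F + (r₂ (X ∩ (F ∩ E₂)) + (c₁ + c₂))  ∎))
    (λ eq → Flat₁₂⇒IsFlat (F⊆E , F₁-flat , F₂-flat) , +-cancelʳ-≡ (r₂ X) _ _ (begin
      rᴾ (ground P) + r₂ X                    ≡⟨ identity ⟩
      rᴾ F + (r₂ (X ∩ (F ∩ E₂)) + (c₁ + c₂))  ≡⟨ cong (rᴾ F +_) (sym eq) ⟩
      rᴾ F + (k + r₂ X)                       ≡⟨ sym (+-assoc (rᴾ F) k _) ⟩
      (rᴾ F + k) + r₂ X                       ∎))
    where
    open ≡-Reasoning
    identity : rᴾ (ground P) + r₂ X ≡ rᴾ F + (r₂ (X ∩ (F ∩ E₂)) + (c₁ + c₂))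
    identity = corank-identity F⊆E F₁-corank F₂-corank

module CorankTwoFlats {N : ℕ} (M₁ M₂ P : Matroid N) (n : ℕ)
  (restrictions-equal : RestrictionsEqual M₁ M₂ (ground M₁ ∩ ground M₂))
  (X-modular : IsModularFlat M₂ (ground M₁ ∩ ground M₂))
  (n≥2 : n ≥ 2)
  (X-U₂ₙ : RestrictionIsU2 M₂ (ground M₁ ∩ ground M₂) n)
  (P-parallel : IsGenParallelConnection (ground M₁ ∩ ground M₂) M₁ M₂ P) where

  open GeneralizedParallelConnection M₁ M₂ P restrictions-equal X-modular P-parallel

  private
    E₁ E₂ X : Subset N
    E₁ = ground M₁
    E₂ = ground M₂
    X = E₁ ∩ E₂
    r₂ : Subset N → ℕ
    r₂ = rank M₂
    module M₁ = MatroidProperties M₁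
    module M₂ = MatroidProperties M₂
    open ModularFlatProperties M₂ X-modular using (rank-≤-∩-rank+corank)
    variable
      F : Subset N
      c₁ c₂ m : ℕ

  CorankTwoCases : Subset N → Set
  CorankTwoCases F =
    (E₁ ⊆ F × CorankFlat 2 M₂ (F ∩ E₂) × X ⊆ F ∩ E₂)
    ⊎ (E₂ ⊆ F × CorankFlat 2 M₁ (F ∩ E₁) × X ⊆ F ∩ E₁)
    ⊎ (IsHyperplane M₁ (F ∩ E₁) × X ⊆ F ∩ E₁ × IsHyperplane M₂ (F ∩ E₂) × X ⊆ F ∩ E₂)
    ⊎ (∣ F ∩ X ∣ ≡ 1 × IsHyperplane M₁ (F ∩ E₁) × CorankFlat 2 M₂ (F ∩ E₂))
    ⊎ (∣ F ∩ X ∣ ≡ 1 × CorankFlat 2 M₁ (F ∩ E₁) × IsHyperplane M₂ (F ∩ E₂))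
    ⊎ (F ∩ X ≡ ⊥ × IsHyperplane M₁ (F ∩ E₁) × CorankFlat 3 M₂ (F ∩ E₂))
    ⊎ (F ∩ X ≡ ⊥ × CorankFlat 2 M₁ (F ∩ E₁) × CorankFlat 2 M₂ (F ∩ E₂))

  rank-X : r₂ X ≡ 2
  rank-X = trans (proj₂ (proj₂ X-U₂ₙ) X (λ x∈ → x∈))
                 (trans (cong (2 ⊓_) (proj₁ (proj₂ X-U₂ₙ))) (m≤n⇒m⊓n≡m n≥2))

  rank-meet : ∣ F ∩ X ∣ ≡ m → r₂ (X ∩ (F ∩ E₂)) ≡ 2 ⊓ m
  rank-meet {F} size = trans (M₂.rank-cong X∩F₂⊆F∩X F∩X⊆X∩F₂ (λ x∈ → ∩⁻ʳ (∩⁻ʳ x∈)))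
                             (trans (proj₂ (proj₂ X-U₂ₙ) (F ∩ X) ∩⁻ʳ) (cong (2 ⊓_) size))
    where
    X∩F₂⊆F∩X : X ∩ (F ∩ E₂) ⊆ F ∩ X
    X∩F₂⊆F∩X = ∩-greatest (λ x∈ → ∩⁻ˡ (∩⁻ʳ x∈)) ∩⁻ˡ
    F∩X⊆X∩F₂ : F ∩ X ⊆ X ∩ (F ∩ E₂)
    F∩X⊆X∩F₂ = ∩-greatest ∩⁻ʳ (∩-greatest ∩⁻ˡ (λ x∈ → ∩⁻ʳ (∩⁻ʳ x∈)))

  X⊆⇒rank-meet≡2 : X ⊆ F → r₂ (X ∩ (F ∩ E₂)) ≡ 2
  X⊆⇒rank-meet≡2 X⊆F = trans (M₂.rank-cong ∩⁻ˡ (∩-greatest (λ x∈ → x∈) (∩-greatest X⊆F ∩⁻ʳ)) ∩⁻ʳ) rank-X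

  rank-meet≡2⇒X⊆ : IsFlat M₂ (F ∩ E₂) → r₂ (X ∩ (F ∩ E₂)) ≡ 2 → X ⊆ F ∩ E₂
  rank-meet≡2⇒X⊆ F₂-flat meet≡2 = M₂.rank-≤-∩-isFlat⇒⊆ F₂-flat ∩⁻ʳ (≤-reflexive (trans rank-X (sym meet≡2)))

  X⊆F₂⇒X⊆F₁ : X ⊆ F ∩ E₂ → X ⊆ F ∩ E₁
  X⊆F₂⇒X⊆F₁ X⊆F₂ = ∩-greatest (λ x∈ → ∩⁻ˡ (X⊆F₂ x∈)) ∩⁻ˡ

  CorankFlat-0⇒rank-meet≡2 : CorankFlat 0 M₁ (F ∩ E₁) → r₂ (X ∩ (F ∩ E₂)) ≡ 2
  CorankFlat-0⇒rank-meet≡2 F₁-corank = X⊆⇒rank-meet≡2 (λ x∈ → ∩⁻ˡ (M₁.CorankFlat-0⇒ground⊆ F₁-corank (∩⁻ˡ x∈)))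

  two-≤-rank-meet+corank : CorankFlat c₂ M₂ (F ∩ E₂) → r₂ (X ∩ (F ∩ E₂)) ≡ m → 2 ≤ m + c₂
  two-≤-rank-meet+corank {c₂} F₂-corank meet≡ =
    subst₂ (λ k s → k ≤ s + c₂) rank-X meet≡ (rank-≤-∩-rank+corank F₂-corank)

  corank-two⇔ : F ⊆ E₁ ∪ E₂ → CorankFlat c₁ M₁ (F ∩ E₁) → CorankFlat c₂ M₂ (F ∩ E₂) →
                r₂ (X ∩ (F ∩ E₂)) ≡ m → CorankFlat 2 P F ⇔ (4 ≡ m + (c₁ + c₂))
  corank-two⇔ {F} {c₁} {c₂} F⊆E F₁-corank F₂-corank meet≡ =
    subst₂ (λ k s → CorankFlat 2 P F ⇔ (2 + k ≡ s + (c₁ + c₂))) rank-X meet≡ (CorankFlat⇔ F⊆E F₁-corank F₂-corank)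

  containing-cases : X ⊆ F ∩ E₂ → CorankFlat c₁ M₁ (F ∩ E₁) → CorankFlat c₂ M₂ (F ∩ E₂) →
                     4 ≡ 2 + (c₁ + c₂) → CorankTwoCases F
  containing-cases {c₁ = 0} X⊆F₂ F₁-corank F₂-corank refl =
    inj₁ ((λ x∈ → ∩⁻ˡ (M₁.CorankFlat-0⇒ground⊆ F₁-corank x∈)) , F₂-corank , X⊆F₂)
  containing-cases {c₁ = 1} X⊆F₂ F₁-corank F₂-corank refl =
    inj₂ (inj₂ (inj₁ (F₁-corank , X⊆F₂⇒X⊆F₁ X⊆F₂ , F₂-corank , X⊆F₂)))
  containing-cases {c₁ = 2} X⊆F₂ F₁-corank F₂-corank refl =
    inj₂ (inj₁ ((λ x∈ → ∩⁻ˡ (M₂.CorankFlat-0⇒ground⊆ F₂-corank x∈)) , F₁-corank , X⊆F₂⇒X⊆F₁ X⊆F₂))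
  containing-cases {c₁ = suc (suc (suc _))} _ _ _ ()

  single-cases : ∣ F ∩ X ∣ ≡ 1 → r₂ (X ∩ (F ∩ E₂)) ≡ 1 → CorankFlat c₁ M₁ (F ∩ E₁) →
                 CorankFlat c₂ M₂ (F ∩ E₂) → 4 ≡ 1 + (c₁ + c₂) → CorankTwoCases F
  single-cases {c₁ = 0} _ meet≡1 F₁-corank _ refl =
    ⊥-elim (1+n≢n (trans (sym (CorankFlat-0⇒rank-meet≡2 F₁-corank)) meet≡1))
  single-cases {c₁ = 1} size _ F₁-corank F₂-corank refl =
    inj₂ (inj₂ (inj₂ (inj₁ (size , F₁-corank , F₂-corank))))
  single-cases {c₁ = 2} size _ F₁-corank F₂-corank refl =
    inj₂ (inj₂ (inj₂ (inj₂ (inj₁ (size , F₁-corank , F₂-corank)))))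
  single-cases {c₁ = 3} _ meet≡1 _ F₂-corank refl =
    ⊥-elim (<⇒≱ (n<1+n 1) (two-≤-rank-meet+corank F₂-corank meet≡1))
  single-cases {c₁ = suc (suc (suc (suc _)))} _ _ _ _ ()

  disjoint-cases : F ∩ X ≡ ⊥ → r₂ (X ∩ (F ∩ E₂)) ≡ 0 → CorankFlat c₁ M₁ (F ∩ E₁) →
                   CorankFlat c₂ M₂ (F ∩ E₂) → 4 ≡ 0 + (c₁ + c₂) → CorankTwoCases F
  disjoint-cases {c₁ = 0} _ meet≡0 F₁-corank _ refl =
    ⊥-elim (0≢1+n (trans (sym meet≡0) (CorankFlat-0⇒rank-meet≡2 F₁-corank)))
  disjoint-cases {c₁ = 1} disjoint _ F₁-corank F₂-corank refl =
    inj₂ (inj₂ (inj₂ (inj₂ (inj₂ (inj₁ (disjoint , F₁-corank , F₂-corank))))))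
  disjoint-cases {c₁ = 2} disjoint _ F₁-corank F₂-corank refl =
    inj₂ (inj₂ (inj₂ (inj₂ (inj₂ (inj₂ (disjoint , F₁-corank , F₂-corank))))))
  disjoint-cases {c₁ = 3} _ meet≡0 _ F₂-corank refl =
    ⊥-elim (<⇒≱ (n<1+n 1) (two-≤-rank-meet+corank F₂-corank meet≡0))
  disjoint-cases {c₁ = 4} _ meet≡0 _ F₂-corank refl =
    ⊥-elim (<⇒≱ z<s (two-≤-rank-meet+corank F₂-corank meet≡0))
  disjoint-cases {c₁ = suc (suc (suc (suc (suc _))))} _ _ _ _ ()

  corank-two⇒cases : F ⊆ E₁ ∪ E₂ → CorankFlat 2 P F → CorankTwoCases F
  corank-two⇒cases {F} F⊆E F-corank = by-size ∣ F ∩ X ∣ refl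
    where
    F₁₂ : Flat₁₂ F
    F₁₂ = IsFlat⇒Flat₁₂ (proj₁ F-corank)
    k₁ k₂ : ℕ
    k₁ = rank M₁ E₁ ∸ rank M₁ (F ∩ E₁)
    k₂ = r₂ E₂ ∸ r₂ (F ∩ E₂)
    F₁-corank : CorankFlat k₁ M₁ (F ∩ E₁)
    F₁-corank = M₁.isFlat⇒CorankFlat (proj₁ (proj₂ F₁₂))
    F₂-corank : CorankFlat k₂ M₂ (F ∩ E₂)
    F₂-corank = M₂.isFlat⇒CorankFlat (proj₂ (proj₂ F₁₂))
    equation : r₂ (X ∩ (F ∩ E₂)) ≡ m → 4 ≡ m + (k₁ + k₂)
    equation meet≡ = Equivalence.to (corank-two⇔ F⊆E F₁-corank F₂-corank meet≡) F-corank
    by-size : ∀ m → ∣ F ∩ X ∣ ≡ m → CorankTwoCases F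
    by-size 0 size =
      disjoint-cases (∣p∣≡0⇒p≡⊥ size) (rank-meet size) F₁-corank F₂-corank (equation (rank-meet size))
    by-size 1 size =
      single-cases size (rank-meet size) F₁-corank F₂-corank (equation (rank-meet size))
    by-size (suc (suc m)) size =
      containing-cases (rank-meet≡2⇒X⊆ (proj₂ (proj₂ F₁₂)) (rank-meet size)) F₁-corank F₂-corank
                       (equation (rank-meet size))

  cases⇒corank-two : F ⊆ E₁ ∪ E₂ → CorankTwoCases F → CorankFlat 2 P F
  cases⇒corank-two F⊆E (inj₁ (E₁⊆F , F₂-corank , X⊆F₂)) =
    Equivalence.from (corank-two⇔ F⊆E (M₁.ground⊆⇒CorankFlat-0 E₁⊆F) F₂-corank
                                      (X⊆⇒rank-meet≡2 (λ x∈ → ∩⁻ˡ (X⊆F₂ x∈)))) refl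
  cases⇒corank-two F⊆E (inj₂ (inj₁ (E₂⊆F , F₁-corank , X⊆F₁))) =
    Equivalence.from (corank-two⇔ F⊆E F₁-corank (M₂.ground⊆⇒CorankFlat-0 E₂⊆F)
                                      (X⊆⇒rank-meet≡2 (λ x∈ → ∩⁻ˡ (X⊆F₁ x∈)))) refl
  cases⇒corank-two F⊆E (inj₂ (inj₂ (inj₁ (F₁-corank , X⊆F₁ , F₂-corank , _)))) =
    Equivalence.from (corank-two⇔ F⊆E F₁-corank F₂-corank (X⊆⇒rank-meet≡2 (λ x∈ → ∩⁻ˡ (X⊆F₁ x∈)))) refl
  cases⇒corank-two F⊆E (inj₂ (inj₂ (inj₂ (inj₁ (size , F₁-corank , F₂-corank))))) =
    Equivalence.from (corank-two⇔ F⊆E F₁-corank F₂-corank (rank-meet size)) refl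
  cases⇒corank-two F⊆E (inj₂ (inj₂ (inj₂ (inj₂ (inj₁ (size , F₁-corank , F₂-corank)))))) =
    Equivalence.from (corank-two⇔ F⊆E F₁-corank F₂-corank (rank-meet size)) refl
  cases⇒corank-two F⊆E (inj₂ (inj₂ (inj₂ (inj₂ (inj₂ (inj₁ (disjoint , F₁-corank , F₂-corank))))))) =
    Equivalence.from (corank-two⇔ F⊆E F₁-corank F₂-corank (rank-meet (p≡⊥⇒∣p∣≡0 disjoint))) refl
  cases⇒corank-two F⊆E (inj₂ (inj₂ (inj₂ (inj₂ (inj₂ (inj₂ (disjoint , F₁-corank , F₂-corank))))))) =
    Equivalence.from (corank-two⇔ F⊆E F₁-corank F₂-corank (rank-meet (p≡⊥⇒∣p∣≡0 disjoint))) refl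

proposition2p9 : ∀ {N : ℕ} (M₁ M₂ P : Matroid N) (n : ℕ) →
    RestrictionsEqual M₁ M₂ (ground M₁ ∩ ground M₂) →
    IsModularFlat M₂ (ground M₁ ∩ ground M₂) →
    n ≥ 2 →
    RestrictionIsU2 M₂ (ground M₁ ∩ ground M₂) n →
    IsGenParallelConnection (ground M₁ ∩ ground M₂) M₁ M₂ P →
    ∀ (F : Subset N) → F ⊆ ground M₁ ∪ ground M₂ →
    (CorankFlat 2 P F ⇔
      ((ground M₁ ⊆ F × CorankFlat 2 M₂ (F ∩ ground M₂) × ground M₁ ∩ ground M₂ ⊆ F ∩ ground M₂)
      ⊎ (ground M₂ ⊆ F × CorankFlat 2 M₁ (F ∩ ground M₁) × ground M₁ ∩ ground M₂ ⊆ F ∩ ground M₁)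
      ⊎ (IsHyperplane M₁ (F ∩ ground M₁) × ground M₁ ∩ ground M₂ ⊆ F ∩ ground M₁
          × IsHyperplane M₂ (F ∩ ground M₂) × ground M₁ ∩ ground M₂ ⊆ F ∩ ground M₂)
      ⊎ (∣ F ∩ (ground M₁ ∩ ground M₂) ∣ ≡ 1
          × IsHyperplane M₁ (F ∩ ground M₁) × CorankFlat 2 M₂ (F ∩ ground M₂))
      ⊎ (∣ F ∩ (ground M₁ ∩ ground M₂) ∣ ≡ 1
          × CorankFlat 2 M₁ (F ∩ ground M₁) × IsHyperplane M₂ (F ∩ ground M₂))
      ⊎ (F ∩ (ground M₁ ∩ ground M₂) ≡ ⊥
          × IsHyperplane M₁ (F ∩ ground M₁) × CorankFlat 3 M₂ (F ∩ ground M₂))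
      ⊎ (F ∩ (ground M₁ ∩ ground M₂) ≡ ⊥
          × CorankFlat 2 M₁ (F ∩ ground M₁) × CorankFlat 2 M₂ (F ∩ ground M₂))))
proposition2p9 M₁ M₂ P n restrictions-equal X-modular n≥2 X-U₂ₙ P-parallel F F⊆E =
  mk⇔ (corank-two⇒cases F⊆E) (cases⇒corank-two F⊆E)
  where open CorankTwoFlats M₁ M₂ P n restrictions-equal X-modular n≥2 X-U₂ₙ P-parallel
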